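{- Let $k\ge1$ and $n\ge1$, and let $d$ be either $d^*$ or $d^\diamond$ on $Z_{2^k}^n$. Suppose $\Gamma:Z_{2^k}^n\to Z_{2^k}^n$ is a $Z_{2^k}$-linear map which is an isometry of $(Z_{2^k}^n,d)$. Then there exist a permutation $\pi$ of the coordinates and $\bar z=(z_1,\dots,z_n)\in\{1,3,\dots,2^k-1\}^n$ such that $\Gamma(\bar x)=\bar z\circ\pi(\bar x)$ for all $\bar x$, where $\pi(\bar x)$ is $\bar x$ with coordinates permuted by $\pi$ and $(z_1,\dots,z_n)\circ(y_1,\dots,y_n)=(z_1y_1,\dots,z_ny_n)$.
   Context: With $m=2^{k-1}$: $wt^*(0)=0$, $wt^*(m)=m$, $wt^*(x)=m/2$ otherwise; $wt^\diamond(0)=0$, $wt^\diamond(x)=1$ for odd $x$, $wt^\diamond(x)=2$ for even $x\ne0$; and $d^*(\bar x,\bar y)=\sum_iwt^*(y_i-x_i)$, $d^\diamond(\bar x,\bar y)=\sum_iwt^\diamond(y_i-x_i)$. -}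

module Defs where

open import Data.Nat using (ℕ; zero; suc; _≟_; _+_; _*_; _∸_; _^_; _/_; _%_; NonZero)
open import Data.Nat.Properties using (m^n≢0)
open import Data.Nat.DivMod using (_mod_)
open import Data.Fin using (Fin; toℕ)
open import Data.Vec using (tabulate)
open import Data.Vec.Base using (sum)
open import Relation.Binary.PropositionalEquality using (_≡_)
open import Relation.Nullary using (yes; no)
open import Data.Product using (_×_)

record Zk (k : ℕ) : Set where
  constructor ⟦_⟧
  field res : Fin (2 ^ k)
open Zk public

val : ∀ {k} → Zk k → ℕ
val a = toℕ (res a)

red : ∀ k → ℕ → Zk k
red k m = ⟦ _mod_ m (2 ^ k) {{m^n≢0 2 k}} ⟧

infixl 6 _⊕_ _⊖_
infixl 7 _⊗_

_⊕_ : ∀ {k} → Zk k → Zk k → Zk k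
_⊕_ {k} a b = red k (val a + val b)

⊝_ : ∀ {k} → Zk k → Zk k
⊝_ {k} a = red k (2 ^ k ∸ val a)

_⊖_ : ∀ {k} → Zk k → Zk k → Zk k
a ⊖ b = a ⊕ (⊝ b)

_⊗_ : ∀ {k} → Zk k → Zk k → Zk k
_⊗_ {k} a b = red k (val a * val b)

Vecᵏ : ℕ → ℕ → Set
Vecᵏ k n = Fin n → Zk k

_+ᵥ_ : ∀ {k n} → Vecᵏ k n → Vecᵏ k n → Vecᵏ k n
(x +ᵥ y) i = x i ⊕ y i

_·ᵥ_ : ∀ {k n} → Zk k → Vecᵏ k n → Vecᵏ k n
(a ·ᵥ x) i = a ⊗ x i

half : ℕ → ℕ
half k = 2 ^ (k ∸ 1)

wt* : ∀ {k} → Zk k → ℕ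
wt* {k} a with val a
... | zero = 0
... | suc j with suc j ≟ half k
...   | yes _ = half k
...   | no _ = half k / 2

wt◇ : ∀ {k} → Zk k → ℕ
wt◇ a with val a
... | zero = 0
... | suc j with suc j % 2
...   | zero = 2
...   | suc _ = 1

data Metric : Set where
  star diamond : Metric

wt : Metric → ∀ {k} → Zk k → ℕ
wt star = wt*
wt diamond = wt◇

dist : Metric → ∀ {k n} → Vecᵏ k n → Vecᵏ k n → ℕ
dist μ x y = sum (tabulate (λ i → wt μ (y i ⊖ x i)))

IsLinear : ∀ {k n} → (Vecᵏ k n → Vecᵏ k n) → Set
IsLinear {k} {n} Γ =
  (∀ (x y : Vecᵏ k n) (i : Fin n) → Γ (x +ᵥ y) i ≡ (Γ x +ᵥ Γ y) i) ×
  (∀ (a : Zk k) (x : Vecᵏ k n) (i : Fin n) → Γ (a ·ᵥ x) i ≡ (a ·ᵥ Γ x) i)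

IsIsometry : Metric → ∀ {k n} → (Vecᵏ k n → Vecᵏ k n) → Set
IsIsometry μ {k} {n} Γ = ∀ (x y : Vecᵏ k n) → dist μ (Γ x) (Γ y) ≡ dist μ x y

IsOdd : ∀ {k} → Zk k → Set
IsOdd a = val a % 2 ≡ 1

-- An isometry Γ is injective, and being linear it fixes 0, so it preserves weights.
-- With m = 2^(k-1), m times an even residue is 0; hence Γ(e_j) has an odd entry, as
-- otherwise Γ(m e_j) = m Γ(e_j) = 0 although m e_j ≠ 0.  An odd entry already has weight
-- wt(1) = wt(e_j) and nonzero residues have positive weight, so Γ(e_j) = z_j e_(p j) with
-- z_j odd.  Then Γ(m e_j) = m e_(p j), so p is injective, hence a permutation, and a linear
-- map is determined by its values on the unit vectors.
module Submission where

open import Defs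
open import Data.Nat using (ℕ; zero; suc; _+_; _*_; _∸_; _^_; _/_; _%_; _≤_; _<_; _≟_; _<?_; z≤n; s≤s; NonZero)
open import Data.Nat.Properties
  using ( m^n≢0; m^n>0; ^-monoʳ-<; n<1+n; m<n⇒m<1+n; <-cmp; <-irrefl; <⇒≤; ≤⇒≯; ≤-refl; ≤-trans; ≤-reflexive
        ; n≤0⇒n≡0; 1+n≢0; *-monoʳ-≤; m≤m+n; m≤n+m; +-monoʳ-≤; +-cancelˡ-≤; +-identityʳ; +-assoc; +-comm; *-comm; *-assoc
        ; *-distribˡ-+; *-identityʳ; *-zeroʳ; m∸n+n≡m; m+[n∸m]≡n; module ≤-Reasoning)
open import Data.Nat.DivMod
  using ( m%n<n; m<n⇒m%n≡m; n%n≡0; m*n%n≡0; [m+kn]%n≡m%n; m≡m%n+[m/n]*n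
        ; %-distribˡ-+; %-distribˡ-*; m/n≡0⇒m<n)
open import Data.Nat.Solver using (module +-*-Solver)
open import Data.Fin using (Fin; zero; suc; toℕ; fromℕ<; punchOut) renaming (_≟_ to _≟ᶠ_)
open import Data.Fin.Properties
  using (toℕ-fromℕ<; toℕ-injective; toℕ<n; any?; punchOut-injective; injective⇒≤)
  renaming (suc-injective to Fin-suc-injective)
open import Data.Fin.Permutation using (Permutation′; _⟨$⟩ʳ_; permutation)
open import Data.Vec using (tabulate)
open import Data.Vec.Base using (sum)
open import Data.Vec.Properties using (tabulate-cong)
open import Data.Product using (Σ; _×_; _,_; proj₁; proj₂; ∃)
open import Data.Sum using (_⊎_; inj₁; inj₂)
open import Data.Empty using (⊥-elim)
open import Function using (_∘_)
open import Function.Definitions using (Injective)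
open import Relation.Binary.Definitions using (tri<; tri≈; tri>)
open import Relation.Binary.PropositionalEquality
open import Relation.Nullary using (yes; no)

injective⇒surjective : ∀ {n} (f : Fin n → Fin n) → Injective _≡_ _≡_ f → ∀ i → ∃ λ j → f j ≡ i
injective⇒surjective {zero} f f-inj ()
injective⇒surjective {suc n} f f-inj i with any? (λ j → f j ≟ᶠ i)
... | yes hit = hit
... | no miss = ⊥-elim (<-irrefl refl (injective⇒≤ g-inj))
  where
  i≢f : ∀ j → i ≢ f j
  i≢f j i≡fj = miss (j , sym i≡fj)
  g : Fin (suc n) → Fin n
  g j = punchOut (i≢f j)
  g-inj : Injective _≡_ _≡_ g
  g-inj {a} {b} eq = f-inj (punchOut-injective (i≢f a) (i≢f b) eq)

even-or-odd : ∀ m → m % 2 ≡ 0 ⊎ m % 2 ≡ 1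
even-or-odd m with m % 2 | m%n<n m 2
... | 0 | _ = inj₁ refl
... | 1 | _ = inj₂ refl
... | suc (suc _) | s≤s (s≤s ())

sum-tabulate-≡0 : ∀ {n} {f : Fin n → ℕ} → (∀ i → f i ≡ 0) → sum (tabulate f) ≡ 0
sum-tabulate-≡0 {zero} _ = refl
sum-tabulate-≡0 {suc n} f≡0 = cong₂ _+_ (f≡0 zero) (sum-tabulate-≡0 (f≡0 ∘ suc))

sum-tabulate-≥ : ∀ {n} (f : Fin n → ℕ) i → f i ≤ sum (tabulate f)
sum-tabulate-≥ f zero = m≤m+n (f zero) _
sum-tabulate-≥ f (suc i) = ≤-trans (sum-tabulate-≥ (λ j → f (suc j)) i) (m≤n+m _ (f zero))

sum-tabulate-≡0⁻¹ : ∀ {n} (f : Fin n → ℕ) → sum (tabulate f) ≡ 0 → ∀ i → f i ≡ 0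
sum-tabulate-≡0⁻¹ f sum≡0 i = n≤0⇒n≡0 (≤-trans (sum-tabulate-≥ f i) (≤-reflexive sum≡0))

sum-tabulate-pair : ∀ {n} (f : Fin n → ℕ) {p q} → p ≢ q → f p + f q ≤ sum (tabulate f)
sum-tabulate-pair f {zero} {zero} p≢q = ⊥-elim (p≢q refl)
sum-tabulate-pair f {zero} {suc q} _ = +-monoʳ-≤ (f zero) (sum-tabulate-≥ (λ j → f (suc j)) q)
sum-tabulate-pair f {suc p} {zero} _ =
  ≤-trans (≤-reflexive (+-comm (f (suc p)) (f zero))) (+-monoʳ-≤ (f zero) (sum-tabulate-≥ (λ j → f (suc j)) p))
sum-tabulate-pair f {suc p} {suc q} p≢q =
  ≤-trans (sum-tabulate-pair (λ j → f (suc j)) (λ p≡q → p≢q (cong suc p≡q))) (m≤n+m _ (f zero))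

sum-tabulate-single : ∀ {n} (f : Fin n → ℕ) p → (∀ i → i ≢ p → f i ≡ 0) → sum (tabulate f) ≡ f p
sum-tabulate-single f zero rest≡0 =
  trans (cong (f zero +_) (sum-tabulate-≡0 (λ i → rest≡0 (suc i) (λ ())))) (+-identityʳ (f zero))
sum-tabulate-single f (suc p) rest≡0 =
  cong₂ _+_ (rest≡0 zero (λ ()))
            (sum-tabulate-single (λ j → f (suc j)) p (λ i i≢p → rest≡0 (suc i) (i≢p ∘ Fin-suc-injective)))

module _ {k : ℕ} where
  open ≡-Reasoning

  private
    N : ℕ
    N = 2 ^ k
    instance
      N≢0 : NonZero N
      N≢0 = m^n≢0 2 k

  val-red : ∀ m → val (red k m) ≡ m % N
  val-red m = toℕ-fromℕ< (m%n<n m N)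

  val< : (a : Zk k) → val a < N
  val< a = toℕ<n (res a)

  val-injective : {a b : Zk k} → val a ≡ val b → a ≡ b
  val-injective {⟦ _ ⟧} {⟦ _ ⟧} eq = cong ⟦_⟧ (toℕ-injective eq)

  red-val : (a : Zk k) → red k (val a) ≡ a
  red-val a = val-injective (trans (val-red (val a)) (m<n⇒m%n≡m (val< a)))

  red-≡ : ∀ {m m'} → m % N ≡ m' % N → red k m ≡ red k m'
  red-≡ {m} {m'} eq = val-injective (trans (val-red m) (trans eq (sym (val-red m'))))

  red-+ : ∀ m m' → red k m ⊕ red k m' ≡ red k (m + m')
  red-+ m m' = red-≡ (begin
    (val (red k m) + val (red k m')) % N ≡⟨ cong₂ (λ a b → (a + b) % N) (val-red m) (val-red m') ⟩
    (m % N + m' % N) % N                 ≡⟨ %-distribˡ-+ m m' N ⟨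
    (m + m') % N                         ∎)

  red-* : ∀ m m' → red k m ⊗ red k m' ≡ red k (m * m')
  red-* m m' = red-≡ (begin
    (val (red k m) * val (red k m')) % N ≡⟨ cong₂ (λ a b → (a * b) % N) (val-red m) (val-red m') ⟩
    (m % N * (m' % N)) % N               ≡⟨ %-distribˡ-* m m' N ⟨
    (m * m') % N                         ∎)

  𝟘 𝟙 : Zk k
  𝟘 = red k 0
  𝟙 = red k 1

  val-𝟘 : val 𝟘 ≡ 0
  val-𝟘 = trans (val-red 0) (m*n%n≡0 0 N)

  red-multiple : ∀ q → red k (q * N) ≡ 𝟘
  red-multiple q = red-≡ (trans (m*n%n≡0 q N) (sym (m*n%n≡0 0 N)))

  red-modulus : red k N ≡ 𝟘
  red-modulus = red-≡ (trans (n%n≡0 N) (sym (m*n%n≡0 0 N)))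

  ⊕-assoc : (a b c : Zk k) → (a ⊕ b) ⊕ c ≡ a ⊕ (b ⊕ c)
  ⊕-assoc a b c = begin
    (a ⊕ b) ⊕ c                            ≡⟨ cong ((a ⊕ b) ⊕_) (red-val c) ⟨
    red k (val a + val b) ⊕ red k (val c) ≡⟨ red-+ (val a + val b) (val c) ⟩
    red k (val a + val b + val c)         ≡⟨ cong (red k) (+-assoc (val a) (val b) (val c)) ⟩
    red k (val a + (val b + val c))       ≡⟨ red-+ (val a) (val b + val c) ⟨
    red k (val a) ⊕ (b ⊕ c)               ≡⟨ cong (_⊕ (b ⊕ c)) (red-val a) ⟩
    a ⊕ (b ⊕ c)                           ∎

  ⊕-identityˡ : (a : Zk k) → 𝟘 ⊕ a ≡ a
  ⊕-identityˡ a = trans (cong (𝟘 ⊕_) (sym (red-val a))) (trans (red-+ 0 (val a)) (red-val a))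

  ⊕-identityʳ : (a : Zk k) → a ⊕ 𝟘 ≡ a
  ⊕-identityʳ a = begin
    a ⊕ 𝟘                   ≡⟨ cong (_⊕ 𝟘) (red-val a) ⟨
    red k (val a) ⊕ red k 0 ≡⟨ red-+ (val a) 0 ⟩
    red k (val a + 0)       ≡⟨ cong (red k) (+-identityʳ (val a)) ⟩
    red k (val a)           ≡⟨ red-val a ⟩
    a                       ∎

  ⊝-inverseˡ : (a : Zk k) → ⊝ a ⊕ a ≡ 𝟘
  ⊝-inverseˡ a = begin
    ⊝ a ⊕ a                           ≡⟨ cong (⊝ a ⊕_) (red-val a) ⟨
    red k (N ∸ val a) ⊕ red k (val a) ≡⟨ red-+ (N ∸ val a) (val a) ⟩
    red k (N ∸ val a + val a)         ≡⟨ cong (red k) (m∸n+n≡m (<⇒≤ (val< a))) ⟩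
    red k N                           ≡⟨ red-modulus ⟩
    𝟘                                 ∎

  ⊖-self : (a : Zk k) → a ⊖ a ≡ 𝟘
  ⊖-self a = begin
    a ⊖ a                             ≡⟨ cong (_⊖ a) (red-val a) ⟨
    red k (val a) ⊕ red k (N ∸ val a) ≡⟨ red-+ (val a) (N ∸ val a) ⟩
    red k (val a + (N ∸ val a))       ≡⟨ cong (red k) (m+[n∸m]≡n (<⇒≤ (val< a))) ⟩
    red k N                           ≡⟨ red-modulus ⟩
    𝟘                                 ∎

  ⊖-identityʳ : (a : Zk k) → a ⊖ 𝟘 ≡ a
  ⊖-identityʳ a = trans (cong (λ v → a ⊕ red k (N ∸ v)) val-𝟘) (trans (cong (a ⊕_) red-modulus) (⊕-identityʳ a))

  ⊖≡𝟘⇒≡ : {a b : Zk k} → a ⊖ b ≡ 𝟘 → a ≡ b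
  ⊖≡𝟘⇒≡ {a} {b} a⊖b≡𝟘 = begin
    a               ≡⟨ ⊕-identityʳ a ⟨
    a ⊕ 𝟘           ≡⟨ cong (a ⊕_) (⊝-inverseˡ b) ⟨
    a ⊕ (⊝ b ⊕ b)   ≡⟨ ⊕-assoc a (⊝ b) b ⟨
    (a ⊖ b) ⊕ b     ≡⟨ cong (_⊕ b) a⊖b≡𝟘 ⟩
    𝟘 ⊕ b           ≡⟨ ⊕-identityˡ b ⟩
    b               ∎

  ⊗-comm : (a b : Zk k) → a ⊗ b ≡ b ⊗ a
  ⊗-comm a b = cong (red k) (*-comm (val a) (val b))

  ⊗-assoc : (a b c : Zk k) → (a ⊗ b) ⊗ c ≡ a ⊗ (b ⊗ c)
  ⊗-assoc a b c = begin
    (a ⊗ b) ⊗ c                            ≡⟨ cong ((a ⊗ b) ⊗_) (red-val c) ⟨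
    red k (val a * val b) ⊗ red k (val c) ≡⟨ red-* (val a * val b) (val c) ⟩
    red k (val a * val b * val c)         ≡⟨ cong (red k) (*-assoc (val a) (val b) (val c)) ⟩
    red k (val a * (val b * val c))       ≡⟨ red-* (val a) (val b * val c) ⟨
    red k (val a) ⊗ (b ⊗ c)               ≡⟨ cong (_⊗ (b ⊗ c)) (red-val a) ⟩
    a ⊗ (b ⊗ c)                           ∎

  ⊗-distribˡ-⊕ : (a b c : Zk k) → a ⊗ (b ⊕ c) ≡ (a ⊗ b) ⊕ (a ⊗ c)
  ⊗-distribˡ-⊕ a b c = begin
    a ⊗ (b ⊕ c)                              ≡⟨ cong (_⊗ (b ⊕ c)) (red-val a) ⟨
    red k (val a) ⊗ red k (val b + val c)    ≡⟨ red-* (val a) (val b + val c) ⟩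
    red k (val a * (val b + val c))          ≡⟨ cong (red k) (*-distribˡ-+ (val a) (val b) (val c)) ⟩
    red k (val a * val b + val a * val c)    ≡⟨ red-+ (val a * val b) (val a * val c) ⟨
    (a ⊗ b) ⊕ (a ⊗ c)                        ∎

  ⊗-zeroʳ : (a : Zk k) → a ⊗ 𝟘 ≡ 𝟘
  ⊗-zeroʳ a = trans (cong (_⊗ 𝟘) (sym (red-val a))) (trans (red-* (val a) 0) (cong (red k) (*-zeroʳ (val a))))

  ⊗-zeroˡ : (a : Zk k) → 𝟘 ⊗ a ≡ 𝟘
  ⊗-zeroˡ a = trans (⊗-comm 𝟘 a) (⊗-zeroʳ a)

  ⊗-identityʳ : (a : Zk k) → a ⊗ 𝟙 ≡ a
  ⊗-identityʳ a = begin
    a ⊗ 𝟙                   ≡⟨ cong (_⊗ 𝟙) (red-val a) ⟨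
    red k (val a) ⊗ red k 1 ≡⟨ red-* (val a) 1 ⟩
    red k (val a * 1)       ≡⟨ cong (red k) (*-identityʳ (val a)) ⟩
    red k (val a)           ≡⟨ red-val a ⟩
    a                       ∎

module _ {k : ℕ} where
  open ≡-Reasoning
  open +-*-Solver using (solve; _:+_; _:*_; _:=_; con)

  private
    N : ℕ
    N = 2 ^ suc k
    instance
      N≢0 : NonZero N
      N≢0 = m^n≢0 2 (suc k)

  2^k<N : 2 ^ k < N
  2^k<N = ^-monoʳ-< 2 (s≤s (s≤s z≤n)) (n<1+n k)

  val-𝟙 : val (𝟙 {suc k}) ≡ 1
  val-𝟙 = trans (val-red {suc k} 1) (m<n⇒m%n≡m (≤-trans (s≤s (m^n>0 2 k)) 2^k<N))

  -- the paper's m = 2^(k-1), where the paper's k is suc k here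
  mid : Zk (suc k)
  mid = red (suc k) (2 ^ k)

  mid≢𝟘 : mid ≢ 𝟘
  mid≢𝟘 mid≡𝟘 = <-irrefl (sym 2^k≡0) (m^n>0 2 k)
    where
    2^k≡0 : 2 ^ k ≡ 0
    2^k≡0 = trans (sym (m<n⇒m%n≡m 2^k<N)) (trans (sym (val-red {suc k} (2 ^ k))) (trans (cong val mid≡𝟘) (val-𝟘 {suc k})))

  mid⊗ : (a : Zk (suc k)) → mid ⊗ a ≡ red (suc k) (2 ^ k * val a)
  mid⊗ a = trans (cong (mid ⊗_) (sym (red-val a))) (red-* (2 ^ k) (val a))

  mid⊗odd : (a : Zk (suc k)) → IsOdd a → mid ⊗ a ≡ mid
  mid⊗odd a odd = begin
    mid ⊗ a                                ≡⟨ mid⊗ a ⟩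
    red (suc k) (2 ^ k * val a)            ≡⟨ cong (λ v → red (suc k) (2 ^ k * v)) val≡1+2q ⟩
    red (suc k) (2 ^ k * (1 + q * 2))      ≡⟨ cong (red (suc k)) (distrib (2 ^ k) q) ⟩
    red (suc k) (2 ^ k + q * N)            ≡⟨ red-≡ ([m+kn]%n≡m%n (2 ^ k) q N) ⟩
    mid                                    ∎
    where
    q = val a / 2
    val≡1+2q : val a ≡ 1 + q * 2
    val≡1+2q = trans (m≡m%n+[m/n]*n (val a) 2) (cong (_+ q * 2) odd)
    distrib : ∀ h q → h * (1 + q * 2) ≡ h + q * (2 * h)
    distrib = solve 2 (λ h q → h :* (con 1 :+ q :* con 2) := h :+ q :* (con 2 :* h)) refl

  mid⊗even : (a : Zk (suc k)) → val a % 2 ≡ 0 → mid ⊗ a ≡ 𝟘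
  mid⊗even a even = begin
    mid ⊗ a                                ≡⟨ mid⊗ a ⟩
    red (suc k) (2 ^ k * val a)            ≡⟨ cong (λ v → red (suc k) (2 ^ k * v)) val≡2q ⟩
    red (suc k) (2 ^ k * (q * 2))          ≡⟨ cong (red (suc k)) (distrib (2 ^ k) q) ⟩
    red (suc k) (q * N)                    ≡⟨ red-multiple q ⟩
    𝟘                                      ∎
    where
    q = val a / 2
    val≡2q : val a ≡ q * 2
    val≡2q = trans (m≡m%n+[m/n]*n (val a) 2) (cong (_+ q * 2) even)
    distrib : ∀ h q → h * (q * 2) ≡ q * (2 * h)
    distrib = solve 2 (λ h q → h :* (q :* con 2) := q :* (con 2 :* h)) refl

-- wt μ as a function of the representative, so that weights of different elements can be compared
wtℕ : Metric → ℕ → ℕ → ℕ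
wtℕ star k zero = 0
wtℕ star k (suc j) with suc j ≟ half k
... | yes _ = half k
... | no _ = half k / 2
wtℕ diamond k zero = 0
wtℕ diamond k (suc j) with suc j % 2
... | zero = 2
... | suc _ = 1

wt≡wtℕ : ∀ μ {k} (a : Zk k) → wt μ a ≡ wtℕ μ k (val a)
wt≡wtℕ star {k} a with val a
... | zero = refl
... | suc j with suc j ≟ half k
...   | yes _ = refl
...   | no _ = refl
wt≡wtℕ diamond a with val a
... | zero = refl
... | suc j with suc j % 2
...   | zero = refl
...   | suc _ = refl

wtℕ-zero : ∀ μ k → wtℕ μ k 0 ≡ 0
wtℕ-zero star k = refl
wtℕ-zero diamond k = refl

wtℕ≡0⇒≡0 : ∀ μ k v → v < 2 ^ k → wtℕ μ k v ≡ 0 → v ≡ 0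
wtℕ≡0⇒≡0 μ k zero _ _ = refl
wtℕ≡0⇒≡0 star zero (suc j) (s≤s ()) _
wtℕ≡0⇒≡0 star (suc zero) (suc zero) _ ()
wtℕ≡0⇒≡0 star (suc zero) (suc (suc j)) (s≤s (s≤s ())) _
wtℕ≡0⇒≡0 star (suc (suc k)) (suc j) _ w≡0 with suc j ≟ half (suc (suc k))
... | yes _ = ⊥-elim (<-irrefl (sym w≡0) (m^n>0 2 (suc k)))
... | no _ = ⊥-elim (≤⇒≯ (*-monoʳ-≤ 2 (m^n>0 2 k)) (m/n≡0⇒m<n w≡0))
wtℕ≡0⇒≡0 diamond k (suc j) _ w≡0 with suc j % 2
wtℕ≡0⇒≡0 diamond k (suc j) _ () | zero
wtℕ≡0⇒≡0 diamond k (suc j) _ () | suc _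

wtℕ-star-odd : ∀ k v → v % 2 ≡ 1 → wtℕ star (suc (suc k)) v ≡ half (suc (suc k)) / 2
wtℕ-star-odd k zero ()
wtℕ-star-odd k (suc j) odd with suc j ≟ half (suc (suc k))
... | no _ = refl
... | yes v≡half = ⊥-elim (1+n≢0 (begin
  1                    ≡⟨ odd ⟨
  suc j % 2            ≡⟨ cong (_% 2) v≡half ⟩
  (2 * 2 ^ k) % 2      ≡⟨ cong (_% 2) (*-comm 2 (2 ^ k)) ⟩
  (2 ^ k * 2) % 2      ≡⟨ m*n%n≡0 (2 ^ k) 2 ⟩
  0                    ∎))
  where open ≡-Reasoning

wtℕ-odd : ∀ μ k v → v < 2 ^ k → v % 2 ≡ 1 → wtℕ μ k v ≡ wtℕ μ k 1
wtℕ-odd μ k zero _ ()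
wtℕ-odd star zero (suc j) (s≤s ()) _
wtℕ-odd star (suc zero) (suc zero) _ _ = refl
wtℕ-odd star (suc zero) (suc (suc j)) (s≤s (s≤s ())) _
wtℕ-odd star (suc (suc k)) v _ odd = trans (wtℕ-star-odd k v odd) (sym (wtℕ-star-odd k 1 refl))
wtℕ-odd diamond k (suc j) _ odd with suc j % 2
wtℕ-odd diamond k (suc j) _ () | zero
wtℕ-odd diamond k (suc j) _ _ | suc _ = refl

module _ (μ : Metric) {k : ℕ} where

  wt-𝟘 : wt μ (𝟘 {k}) ≡ 0
  wt-𝟘 = trans (wt≡wtℕ μ 𝟘) (trans (cong (wtℕ μ k) (val-𝟘 {k})) (wtℕ-zero μ k))

  wt≡0⇒≡𝟘 : {a : Zk k} → wt μ a ≡ 0 → a ≡ 𝟘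
  wt≡0⇒≡𝟘 {a} wt≡0 =
    val-injective (trans (wtℕ≡0⇒≡0 μ k (val a) (val< a) (trans (sym (wt≡wtℕ μ a)) wt≡0)) (sym (val-𝟘 {k})))

wt-odd : ∀ μ {k} {a : Zk (suc k)} → IsOdd a → wt μ a ≡ wt μ (𝟙 {suc k})
wt-odd μ {k} {a} odd = begin
  wt μ a                          ≡⟨ wt≡wtℕ μ a ⟩
  wtℕ μ (suc k) (val a)           ≡⟨ wtℕ-odd μ (suc k) (val a) (val< a) odd ⟩
  wtℕ μ (suc k) 1                 ≡⟨ cong (wtℕ μ (suc k)) (val-𝟙 {k}) ⟨
  wtℕ μ (suc k) (val (𝟙 {suc k})) ≡⟨ wt≡wtℕ μ (𝟙 {suc k}) ⟨
  wt μ 𝟙                          ∎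
  where open ≡-Reasoning

module Vectors {k n : ℕ} where

  0v : Vecᵏ k n
  0v _ = 𝟘

  unit : Fin n → Vecᵏ k n
  unit j i with i ≟ᶠ j
  ... | yes _ = 𝟙
  ... | no _ = 𝟘

  unit-diag : ∀ j → unit j j ≡ 𝟙
  unit-diag j with j ≟ᶠ j
  ... | yes _ = refl
  ... | no j≢j = ⊥-elim (j≢j refl)

  unit-off : ∀ {j i} → i ≢ j → unit j i ≡ 𝟘
  unit-off {j} {i} i≢j with i ≟ᶠ j
  ... | yes i≡j = ⊥-elim (i≢j i≡j)
  ... | no _ = refl

  weight : Metric → Vecᵏ k n → ℕ
  weight μ x = sum (tabulate (λ i → wt μ (x i)))

  module _ (μ : Metric) where

    dist-cong : ∀ {x x' y y' : Vecᵏ k n} → x ≗ x' → y ≗ y' → dist μ x y ≡ dist μ x' y'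
    dist-cong x≗x' y≗y' = cong sum (tabulate-cong (λ i → cong₂ (λ a b → wt μ (b ⊖ a)) (x≗x' i) (y≗y' i)))

    ≗⇒dist≡0 : ∀ {x y : Vecᵏ k n} → x ≗ y → dist μ x y ≡ 0
    ≗⇒dist≡0 {x} x≗y =
      trans (dist-cong {x} {x} (λ _ → refl) (sym ∘ x≗y)) (sum-tabulate-≡0 (λ i → trans (cong (wt μ) (⊖-self (x i))) (wt-𝟘 μ)))

    dist≡0⇒≗ : ∀ {x y : Vecᵏ k n} → dist μ x y ≡ 0 → x ≗ y
    dist≡0⇒≗ {x} {y} dist≡0 i =
      sym (⊖≡𝟘⇒≡ (wt≡0⇒≡𝟘 μ (sum-tabulate-≡0⁻¹ (λ i → wt μ (y i ⊖ x i)) dist≡0 i)))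

    dist-0v : ∀ x → dist μ 0v x ≡ weight μ x
    dist-0v x = cong sum (tabulate-cong (λ i → cong (wt μ) (⊖-identityʳ (x i))))

    weight-unit : ∀ j → weight μ (unit j) ≡ wt μ 𝟙
    weight-unit j = trans (sum-tabulate-single (λ i → wt μ (unit j i)) j
                             (λ i i≢j → trans (cong (wt μ) (unit-off i≢j)) (wt-𝟘 μ)))
                          (cong (wt μ) (unit-diag j))

module Linear {k n : ℕ} where
  open Vectors {k} {n}
  open ≡-Reasoning

  Extensional : (Vecᵏ k n → Vecᵏ k n) → Set
  Extensional Γ = ∀ {x y} → x ≗ y → Γ x ≗ Γ y

  linear-0 : ∀ {Γ} → IsLinear Γ → Extensional Γ → Γ 0v ≗ 0v
  linear-0 {Γ} (_ , homogeneous) ext i = begin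
    Γ 0v i          ≡⟨ ext (λ _ → sym (⊗-zeroˡ 𝟘)) i ⟩
    Γ (𝟘 ·ᵥ 0v) i   ≡⟨ homogeneous 𝟘 0v i ⟩
    𝟘 ⊗ Γ 0v i      ≡⟨ ⊗-zeroˡ (Γ 0v i) ⟩
    𝟘               ∎

  _↾_ : Vecᵏ k n → ℕ → Vecᵏ k n
  (x ↾ t) i with toℕ i <? t
  ... | yes _ = x i
  ... | no _ = 𝟘

  ↾-< : ∀ x {t} i → toℕ i < t → (x ↾ t) i ≡ x i
  ↾-< x {t} i i<t with toℕ i <? t
  ... | yes _ = refl
  ... | no i≮t = ⊥-elim (i≮t i<t)

  ↾-≥ : ∀ x {t} i → t ≤ toℕ i → (x ↾ t) i ≡ 𝟘
  ↾-≥ x {t} i t≤i with toℕ i <? t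
  ... | yes i<t = ⊥-elim (≤⇒≯ t≤i i<t)
  ... | no _ = refl

  ↾-suc : ∀ x {t} j → toℕ j ≡ t → x ↾ suc t ≗ (x ↾ t) +ᵥ (x j ·ᵥ unit j)
  ↾-suc x {t} j j≡t i with <-cmp (toℕ i) t
  ... | tri< i<t _ _ = begin
    (x ↾ suc t) i                 ≡⟨ ↾-< x i (m<n⇒m<1+n i<t) ⟩
    x i                           ≡⟨ ⊕-identityʳ (x i) ⟨
    x i ⊕ 𝟘                       ≡⟨ cong₂ _⊕_ (↾-< x i i<t) (⊗-zeroʳ (x j)) ⟨
    (x ↾ t) i ⊕ x j ⊗ 𝟘           ≡⟨ cong (λ a → (x ↾ t) i ⊕ x j ⊗ a) (unit-off i≢j) ⟨
    (x ↾ t) i ⊕ x j ⊗ unit j i    ∎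
    where
    i≢j : i ≢ j
    i≢j i≡j = <-irrefl (trans (cong toℕ i≡j) j≡t) i<t
  ... | tri> _ _ t<i = begin
    (x ↾ suc t) i                 ≡⟨ ↾-≥ x i t<i ⟩
    𝟘                             ≡⟨ ⊗-zeroʳ (x j) ⟨
    x j ⊗ 𝟘                       ≡⟨ ⊕-identityˡ (x j ⊗ 𝟘) ⟨
    𝟘 ⊕ x j ⊗ 𝟘                   ≡⟨ cong₂ (λ a b → a ⊕ x j ⊗ b) (↾-≥ x i (<⇒≤ t<i)) (unit-off i≢j) ⟨
    (x ↾ t) i ⊕ x j ⊗ unit j i    ∎
    where
    i≢j : i ≢ j
    i≢j i≡j = <-irrefl (sym (trans (cong toℕ i≡j) j≡t)) t<i
  ... | tri≈ _ i≡t _ with toℕ-injective (trans i≡t (sym j≡t))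
  ...   | refl = begin
    (x ↾ suc t) i                 ≡⟨ ↾-< x i (≤-reflexive (cong suc i≡t)) ⟩
    x i                           ≡⟨ ⊗-identityʳ (x i) ⟨
    x i ⊗ 𝟙                       ≡⟨ ⊕-identityˡ (x i ⊗ 𝟙) ⟨
    𝟘 ⊕ x i ⊗ 𝟙                   ≡⟨ cong₂ (λ a b → a ⊕ x i ⊗ b) (↾-≥ x i (≤-reflexive (sym i≡t))) (unit-diag i) ⟨
    (x ↾ t) i ⊕ x i ⊗ unit i i    ∎

  linear-↾-suc : ∀ {Γ} → IsLinear Γ → Extensional Γ → ∀ x {t} j → toℕ j ≡ t →
                 Γ (x ↾ suc t) ≗ λ i → Γ (x ↾ t) i ⊕ x j ⊗ Γ (unit j) i
  linear-↾-suc {Γ} (additive , homogeneous) ext x {t} j j≡t i = begin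
    Γ (x ↾ suc t) i                              ≡⟨ ext (↾-suc x j j≡t) i ⟩
    Γ ((x ↾ t) +ᵥ (x j ·ᵥ unit j)) i             ≡⟨ additive (x ↾ t) (x j ·ᵥ unit j) i ⟩
    Γ (x ↾ t) i ⊕ Γ (x j ·ᵥ unit j) i            ≡⟨ cong (Γ (x ↾ t) i ⊕_) (homogeneous (x j) (unit j) i) ⟩
    Γ (x ↾ t) i ⊕ x j ⊗ Γ (unit j) i             ∎

  linear-unique : ∀ {Γ Δ} → IsLinear Γ → Extensional Γ → IsLinear Δ → Extensional Δ →
                  (∀ j → Γ (unit j) ≗ Δ (unit j)) → ∀ x → Γ x ≗ Δ x
  linear-unique {Γ} {Δ} Γ-lin Γ-ext Δ-lin Δ-ext agree x i = begin
    Γ x i         ≡⟨ Γ-ext (λ i → sym (↾-< x i (toℕ<n i))) i ⟩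
    Γ (x ↾ n) i   ≡⟨ prefixes n ≤-refl i ⟩
    Δ (x ↾ n) i   ≡⟨ Δ-ext (λ i → ↾-< x i (toℕ<n i)) i ⟩
    Δ x i         ∎
    where
    x↾0≗0v : x ↾ 0 ≗ 0v
    x↾0≗0v i = ↾-≥ x i z≤n
    prefixes : ∀ t → t ≤ n → Γ (x ↾ t) ≗ Δ (x ↾ t)
    prefixes zero _ i = begin
      Γ (x ↾ 0) i   ≡⟨ Γ-ext x↾0≗0v i ⟩
      Γ 0v i        ≡⟨ linear-0 Γ-lin Γ-ext i ⟩
      𝟘             ≡⟨ linear-0 Δ-lin Δ-ext i ⟨
      Δ 0v i        ≡⟨ Δ-ext x↾0≗0v i ⟨
      Δ (x ↾ 0) i   ∎
    prefixes (suc t) t<n i = begin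
      Γ (x ↾ suc t) i                    ≡⟨ linear-↾-suc Γ-lin Γ-ext x j j≡t i ⟩
      Γ (x ↾ t) i ⊕ x j ⊗ Γ (unit j) i   ≡⟨ cong₂ (λ a b → a ⊕ x j ⊗ b) (prefixes t (<⇒≤ t<n) i) (agree j i) ⟩
      Δ (x ↾ t) i ⊕ x j ⊗ Δ (unit j) i   ≡⟨ linear-↾-suc Δ-lin Δ-ext x j j≡t i ⟨
      Δ (x ↾ suc t) i                    ∎
      where
      j = fromℕ< t<n
      j≡t = toℕ-fromℕ< t<n

  monomial : Vecᵏ k n → (Fin n → Fin n) → Vecᵏ k n → Vecᵏ k n
  monomial z σ x i = z i ⊗ x (σ i)

  monomial-linear : ∀ z σ → IsLinear (monomial z σ)
  monomial-linear z σ = (λ x y i → ⊗-distribˡ-⊕ (z i) (x (σ i)) (y (σ i)))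
                      , (λ a x i → trans (sym (⊗-assoc (z i) a (x (σ i))))
                                   (trans (cong (_⊗ x (σ i)) (⊗-comm (z i) a)) (⊗-assoc a (z i) (x (σ i)))))

  monomial-extensional : ∀ z σ → Extensional (monomial z σ)
  monomial-extensional z σ x≗y i = cong (z i ⊗_) (x≗y (σ i))

module Isometry {k n : ℕ} (μ : Metric) {Γ : Vecᵏ (suc k) n → Vecᵏ (suc k) n}
                (Γ-lin : IsLinear Γ) (Γ-iso : IsIsometry μ Γ) where
  open Vectors {suc k} {n}
  open Linear {suc k} {n}

  Γ-ext : Extensional Γ
  Γ-ext {x} {y} x≗y = dist≡0⇒≗ μ (trans (Γ-iso x y) (≗⇒dist≡0 μ x≗y))

  Γ-injective : ∀ {x y} → Γ x ≗ Γ y → x ≗ y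
  Γ-injective {x} {y} Γx≗Γy = dist≡0⇒≗ μ (trans (sym (Γ-iso x y)) (≗⇒dist≡0 μ Γx≗Γy))

  Γ-0 : Γ 0v ≗ 0v
  Γ-0 = linear-0 Γ-lin Γ-ext

  weight-Γ : ∀ x → weight μ (Γ x) ≡ weight μ x
  weight-Γ x = begin
    weight μ (Γ x)       ≡⟨ dist-0v μ (Γ x) ⟨
    dist μ 0v (Γ x)      ≡⟨ dist-cong μ (sym ∘ Γ-0) (λ _ → refl) ⟩
    dist μ (Γ 0v) (Γ x)  ≡⟨ Γ-iso 0v x ⟩
    dist μ 0v x          ≡⟨ dist-0v μ x ⟩
    weight μ x           ∎
    where open ≡-Reasoning

  Γ-homogeneous : ∀ a x → Γ (a ·ᵥ x) ≗ a ·ᵥ Γ x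
  Γ-homogeneous = proj₂ Γ-lin

  column : Fin n → Vecᵏ (suc k) n
  column j = Γ (unit j)

  mid·unit-diag : ∀ j → (mid ·ᵥ unit j) j ≡ mid
  mid·unit-diag j = trans (cong (mid ⊗_) (unit-diag j)) (⊗-identityʳ mid)

  column-has-odd-entry : ∀ j → ∃ λ i → IsOdd (column j i)
  column-has-odd-entry j with any? (λ i → val (column j i) % 2 ≟ 1)
  ... | yes odd-entry = odd-entry
  ... | no no-odd-entry = ⊥-elim (mid≢𝟘 (trans (sym (mid·unit-diag j)) (Γ-injective Γ-mid·unit≗Γ0 j)))
    where
    Γ-mid·unit≗Γ0 : Γ (mid ·ᵥ unit j) ≗ Γ 0v
    Γ-mid·unit≗Γ0 i with even-or-odd (val (column j i))
    ... | inj₂ odd = ⊥-elim (no-odd-entry (i , odd))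
    ... | inj₁ even = trans (Γ-homogeneous mid (unit j) i) (trans (mid⊗even _ even) (sym (Γ-0 i)))

  p : Fin n → Fin n
  p j = proj₁ (column-has-odd-entry j)

  column-odd : ∀ j → IsOdd (column j (p j))
  column-odd j = proj₂ (column-has-odd-entry j)

  -- Γ(e_j) has weight wt(1), all of which is carried by its odd entry at p j.
  column-off : ∀ {j i} → p j ≢ i → column j i ≡ 𝟘
  column-off {j} {i} pj≢i = wt≡0⇒≡𝟘 μ (n≤0⇒n≡0 (+-cancelˡ-≤ (wt μ 𝟙) _ 0 (begin
    wt μ 𝟙 + wt μ (column j i)                ≡⟨ cong (_+ wt μ (column j i)) (wt-odd μ (column-odd j)) ⟨
    wt μ (column j (p j)) + wt μ (column j i) ≤⟨ sum-tabulate-pair (λ i → wt μ (column j i)) pj≢i ⟩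
    weight μ (column j)                       ≡⟨ weight-Γ (unit j) ⟩
    weight μ (unit j)                         ≡⟨ weight-unit μ j ⟩
    wt μ 𝟙                                    ≡⟨ +-identityʳ (wt μ 𝟙) ⟨
    wt μ 𝟙 + 0                                ∎)))
    where open ≤-Reasoning

  Γ-mid·unit : ∀ j → Γ (mid ·ᵥ unit j) ≗ mid ·ᵥ unit (p j)
  Γ-mid·unit j i with i ≟ᶠ p j
  ... | yes refl = trans (Γ-homogeneous mid (unit j) i)
                         (trans (mid⊗odd _ (column-odd j)) (sym (⊗-identityʳ mid)))
  ... | no i≢pj = trans (Γ-homogeneous mid (unit j) i)
                        (cong (mid ⊗_) (column-off (i≢pj ∘ sym)))

  p-injective : Injective _≡_ _≡_ p
  p-injective {j} {j'} pj≡pj' with j ≟ᶠ j'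
  ... | yes j≡j' = j≡j'
  ... | no j≢j' = ⊥-elim (mid≢𝟘 (begin
    mid                        ≡⟨ mid·unit-diag j ⟨
    (mid ·ᵥ unit j) j          ≡⟨ Γ-injective Γ-agree j ⟩
    (mid ·ᵥ unit j') j         ≡⟨ cong (mid ⊗_) (unit-off j≢j') ⟩
    mid ⊗ 𝟘                    ≡⟨ ⊗-zeroʳ mid ⟩
    𝟘                          ∎))
    where
    open ≡-Reasoning
    Γ-agree : Γ (mid ·ᵥ unit j) ≗ Γ (mid ·ᵥ unit j')
    Γ-agree i = trans (Γ-mid·unit j i) (trans (cong (λ q → mid ⊗ unit q i) pj≡pj') (sym (Γ-mid·unit j' i)))

  σ : Fin n → Fin n
  σ i = proj₁ (injective⇒surjective p p-injective i)

  p∘σ : ∀ i → p (σ i) ≡ i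
  p∘σ i = proj₂ (injective⇒surjective p p-injective i)

  σ∘p : ∀ j → σ (p j) ≡ j
  σ∘p j = p-injective (p∘σ (p j))

  π : Permutation′ n
  π = permutation σ p σ∘p p∘σ

  z : Vecᵏ (suc k) n
  z i = column (σ i) i

  z-odd : ∀ i → IsOdd (z i)
  z-odd i = subst (λ t → IsOdd (column (σ i) t)) (p∘σ i) (column-odd (σ i))

  columns-monomial : ∀ j → Γ (unit j) ≗ monomial z σ (unit j)
  columns-monomial j i with σ i ≟ᶠ j
  ... | yes refl = sym (⊗-identityʳ (z i))
  ... | no σi≢j = trans (column-off (λ pj≡i → σi≢j (trans (cong σ (sym pj≡i)) (σ∘p j)))) (sym (⊗-zeroʳ (z i)))

proposition4 : (k n : ℕ) → 1 ≤ k → 1 ≤ n → (μ : Metric) →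
    (Γ : Vecᵏ k n → Vecᵏ k n) → IsLinear Γ → IsIsometry μ Γ →
    Σ (Permutation′ n) λ π → Σ (Vecᵏ k n) λ z →
    ((i : Fin n) → IsOdd (z i)) ×
    ((x : Vecᵏ k n) (i : Fin n) → Γ x i ≡ z i ⊗ x (π ⟨$⟩ʳ i))
proposition4 zero n () _ μ Γ Γ-lin Γ-iso
proposition4 (suc k) n _ _ μ Γ Γ-lin Γ-iso =
  π , z , z-odd , linear-unique Γ-lin Γ-ext (monomial-linear z σ) (monomial-extensional z σ) columns-monomial
  where
  open Linear {suc k} {n}
  open Isometry μ Γ-lin Γ-iso
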